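{- Let $n\ge 2$ be an even natural number and $m\ge 2$. Let $p_1,\dots,p_l$ be distinct primes such that, for each $i$, $p_i$ is a $\varphi$-divisor of $n$ of degree $k_i$. If $m\le \min(p_1^{k_1}-1,\dots,p_l^{k_l}-1)$, then for every nonnegative integer $b$ and all natural numbers $n_1,\dots,n_l\ge 1$, $$P\Big(\sum_{i=1}^m x_i^n=b\,(p_1^{n_1}p_2^{n_2}\cdots p_l^{n_l})^n\Big)=P\Big(\sum_{i=1}^m x_i^n=b\Big).$$ In particular, if $p_1,\dots,p_l$ are $\varphi$-divisors of $n$ (of any degree), then for every nonnegative integer $b$ and all natural $n_1,\dots,n_l$, $$P\big(x_1^n+x_2^n=b\,(p_1^{n_1}\cdots p_l^{n_l})^n\big)=P\big(x_1^n+x_2^n=b\big).$$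
   Context: For an equation $f(x_1,\dots,x_m)=d$, $P(f(x_1,\dots,x_m)=d)$ denotes the number of its solutions $(x_1,\dots,x_m)$ in nonnegative integers (ordered tuples). $\varphi$ is Euler's totient function. Definition: for an even natural number $n$, a prime $p$ is called a $\varphi$-divisor of $n$ if there exists a natural number $k$ with $p^k\ge 3$ and $\varphi(p^k)\mid n$; the largest such $k$ is called the degree of the $\varphi$-divisor $p$ of $n$. -}

module Defs where

open import Data.Nat using (ℕ; zero; suc; _+_; _*_; _^_; _≤_; _≟_)
open import Data.Nat.Divisibility using (_∣_)
open import Data.Nat.Primality using (Prime)
open import Data.Nat.Coprimality using (coprime?)
open import Data.List using (List; []; _∷_; length; filter; map; upTo; concatMap)
open import Data.Vec using (Vec; []; _∷_)
open import Data.Product using (_×_; Σ)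
open import Data.Fin using (Fin)

φ : ℕ → ℕ
φ n = length (filter (λ k → coprime? k n) (map suc (upTo n)))

boxVecs : (m d : ℕ) → List (Vec ℕ m)
boxVecs zero    d = [] ∷ []
boxVecs (suc m) d = concatMap (λ x → map (x ∷_) (boxVecs m d)) (upTo (suc d))

powSum : {m : ℕ} → ℕ → Vec ℕ m → ℕ
powSum n []       = 0
powSum n (x ∷ xs) = x ^ n + powSum n xs

-- P(x₁ⁿ + … + x_mⁿ = d): number of solutions (x₁,…,x_m) in nonnegative
-- integers.  For n ≥ 1 every solution satisfies xᵢ ≤ d, so enumerating
-- the box {0,…,d}^m counts all solutions.
P : (m n d : ℕ) → ℕ
P m n d = length (filter (λ v → powSum n v ≟ d) (boxVecs m d))

IsφDivisor : ℕ → ℕ → Set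
IsφDivisor n p = Prime p × Σ ℕ (λ k → (1 ≤ k) × (3 ≤ p ^ k) × (φ (p ^ k) ∣ n))

IsφDivisorOfDegree : ℕ → ℕ → ℕ → Set
IsφDivisorOfDegree n p k =
  Prime p × (1 ≤ k) × (3 ≤ p ^ k) × (φ (p ^ k) ∣ n) ×
  ((j : ℕ) → 1 ≤ j → 3 ≤ p ^ j → φ (p ^ j) ∣ n → j ≤ k)

prodFin : (l : ℕ) → (Fin l → ℕ) → ℕ
prodFin zero    f = 1
prodFin (suc l) f = f Fin.zero * prodFin l (λ i → f (Fin.suc i))

-- Let q = p ^ k with p prime and φ q ∣ n. By Euler's theorem x ^ n ≡ 1 (mod q) when p ∤ x,
-- while q ∣ x ^ n when p ∣ x, because k ≤ φ q ≤ n. Hence a sum of m < q n-th powers is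
-- congruent to the number of its terms prime to p, so it is divisible by q only if every
-- base is divisible by p. Solutions of Σ xᵢ ^ n = d p ^ n are therefore exactly p times the
-- solutions of Σ xᵢ ^ n = d, and the theorem follows by iterating over the primes and exponents.
module Submission where

open import Defs
open import Data.Nat using (ℕ; _*_; _^_; _≤_; _∸_)
open import Data.Nat.Divisibility using (_∣_)
open import Data.Fin using (Fin)
open import Data.Product using (_×_)
open import Function.Definitions using (Injective)
open import Relation.Binary.PropositionalEquality using (_≡_)

open import Data.Nat
  using (zero; suc; pred; _+_; _<_; _≟_; z≤n; s≤s; NonZero; >-nonZero; nonTrivial⇒n>1)
open import Data.Nat.Properties
open import Data.Nat.DivMod using (_%_; _/_; m≡m%n+[m/n]*n; %-distribˡ-+; %-distribˡ-*; %-remove-+ˡ; %-remove-+ʳ;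
  m%n%n≡m%n; m%n<n; m<n⇒m%n≡m; n%1≡0)
open import Data.Nat.Divisibility
  using (divides; quotient; m∣n⇒n≡m*quotient; _∣?_; ∣-refl; ∣-trans; ∣1⇒≡1; ∣⇒≤; ∣m+n∣m⇒∣n; m∣m*n; n∣m*n;
         *-pres-∣; n∣m⇒m%n≡0; ∣n∣m%n⇒∣m)
open import Data.Nat.Coprimality as Coprimality
  using (Coprime; coprime?; coprime-divisor; 1-coprimeTo; 0-coprimeTo-m⇒m≡1)
open import Data.Nat.Primality using (Prime; prime⇒irreducible; prime⇒nonZero; prime⇒nonTrivial)
open import Data.Nat.ListAction using (product)
open import Data.Nat.ListAction.Properties using (product-↭)
open import Data.Nat.Solver using (module +-*-Solver)
open import Data.List using (List; []; _∷_; length; filter; map; upTo; applyUpTo; concatMap)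
open import Data.List.Properties using (length-filter; length-map; length-applyUpTo)
open import Data.List.Membership.Propositional using (_∈_; find; lose)
open import Data.List.Membership.Propositional.Properties
  using (∈-filter⁺; ∈-filter⁻; ∈-map⁺; ∈-map⁻; ∈-upTo⁺; ∈-upTo⁻; ∈-applyUpTo⁻;
         ∈-concatMap⁺; ∈-concatMap⁻)
open import Data.List.Membership.Propositional.Properties.WithK using (unique∧set⇒bag)
import Data.List.Membership.DecPropositional as DecMembership
open import Data.List.Relation.Unary.Any using (here; there)
import Data.List.Relation.Unary.All as ListAll
import Data.List.Relation.Unary.All.Properties as ListAllP
open import Data.List.Relation.Unary.AllPairs using ([]; _∷_)
open import Data.List.Relation.Unary.Unique.Propositional using (Unique)
import Data.List.Relation.Unary.Unique.Propositional.Properties as Unique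
open import Data.List.Relation.Binary.Subset.Propositional using (_⊆_)
open import Data.List.Relation.Binary.BagAndSetEquality using (∼bag⇒↭)
open import Data.List.Relation.Binary.Permutation.Propositional using (_↭_)
open import Data.List.Relation.Binary.Permutation.Propositional.Properties using (↭-length)
open import Data.Vec using (Vec; []; _∷_; head; count)
import Data.Vec as Vec
open import Data.Vec.Properties using (∷-injectiveˡ; ∷-injectiveʳ; count≤n)
open import Data.Vec.Relation.Unary.All using (All; []; _∷_)
import Data.Vec.Relation.Unary.All as All
open import Data.Product using (_,_; proj₁; proj₂; Σ)
open import Data.Sum using (inj₁; inj₂)
open import Data.Empty using (⊥-elim)
open import Function.Bundles using (mk⇔)
open import Relation.Binary.Definitions using (DecidableEquality)
open import Relation.Binary.PropositionalEquality
  using (refl; sym; trans; cong; cong₂; subst; subst₂; module ≡-Reasoning)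
open import Relation.Nullary using (¬_; Dec; yes; no; ¬?)

m≤m^n : ∀ m n .{{_ : NonZero n}} → m ≤ m ^ n
m≤m^n zero    (suc n) = z≤n
m≤m^n (suc m) (suc n) = subst (_≤ suc m * suc m ^ n) (*-identityʳ (suc m)) (*-monoʳ-≤ (suc m) (m^n>0 (suc m) n))

^-distribʳ-* : ∀ a b n → (a * b) ^ n ≡ a ^ n * b ^ n
^-distribʳ-* a b zero    = refl
^-distribʳ-* a b (suc n) = trans (cong ((a * b) *_) (^-distribʳ-* a b n))
  (solve 4 (λ a b A B → (a :* b) :* (A :* B) := (a :* A) :* (b :* B)) refl a b (a ^ n) (b ^ n))
  where open +-*-Solver

^-monoˡ-∣ : ∀ {a b} n → a ∣ b → a ^ n ∣ b ^ n
^-monoˡ-∣ zero    a∣b = ∣-refl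
^-monoˡ-∣ (suc n) a∣b = *-pres-∣ a∣b (^-monoˡ-∣ n a∣b)

module _ {A : Set} where

  unique∧⊆∧⊇⇒↭ : {xs ys : List A} → Unique xs → Unique ys → xs ⊆ ys → ys ⊆ xs → xs ↭ ys
  unique∧⊆∧⊇⇒↭ ux uy xs⊆ys ys⊆xs = ∼bag⇒↭ (unique∧set⇒bag ux uy (mk⇔ xs⊆ys ys⊆xs))

  unique-map⁺ : {B : Set} {f : A → B} {xs : List A} →
    (∀ {a b} → a ∈ xs → b ∈ xs → f a ≡ f b → a ≡ b) → Unique xs → Unique (map f xs)
  unique-map⁺ {xs = []}     _   []         = []
  unique-map⁺ {xs = x ∷ xs} inj (x∉ ∷ uxs) =
    ListAllP.map⁺ (ListAll.tabulate λ y∈ fx≡fy → ListAll.lookup x∉ y∈ (inj (here refl) (there y∈) fx≡fy))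
    ∷ unique-map⁺ (λ a∈ b∈ → inj (there a∈) (there b∈)) uxs

  unique-concatMap⁺ : {B : Set} (f : A → List B) (tag : B → A) →
    (∀ {x y} → y ∈ f x → tag y ≡ x) → (∀ x → Unique (f x)) → {xs : List A} → Unique xs →
    Unique (concatMap f xs)
  unique-concatMap⁺ f tag tag-f uf {[]}     []         = []
  unique-concatMap⁺ f tag tag-f uf {x ∷ xs} (x∉ ∷ uxs) =
    Unique.++⁺ (uf x) (unique-concatMap⁺ f tag tag-f uf uxs) disjoint
    where
    disjoint : ∀ {y} → ¬ (y ∈ f x × y ∈ concatMap f xs)
    disjoint (y∈fx , y∈rest) with find (∈-concatMap⁻ f {xs = xs} y∈rest)
    ... | x′ , x′∈ , y∈fx′ = ListAll.lookup x∉ x′∈ (trans (sym (tag-f y∈fx)) (tag-f y∈fx′))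

module _ {A : Set} (_≟ᴬ_ : DecidableEquality A) where
  open DecMembership _≟ᴬ_ using (_∈?_)

  unique∧⊆⇒length≤ : {xs ys : List A} → Unique xs → Unique ys → xs ⊆ ys →
    length xs ≤ length ys
  unique∧⊆⇒length≤ {xs} {ys} ux uy xs⊆ys =
    subst (_≤ length ys) (sym (↭-length xs↭ys∩xs)) (length-filter (_∈? xs) ys)
    where
    xs↭ys∩xs : xs ↭ filter (_∈? xs) ys
    xs↭ys∩xs = unique∧⊆∧⊇⇒↭ ux (Unique.filter⁺ (_∈? xs) uy)
      (λ x∈ → ∈-filter⁺ (_∈? xs) (xs⊆ys x∈) x∈)
      (λ x∈ → proj₂ (∈-filter⁻ (_∈? xs) {xs = ys} x∈))

  -- Pigeonhole: a missing element of ys could be added to xs, making it longer than ys.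
  unique∧⊆∧length≥⇒↭ : {xs ys : List A} → Unique xs → Unique ys → xs ⊆ ys →
    length ys ≤ length xs → xs ↭ ys
  unique∧⊆∧length≥⇒↭ {xs} {ys} ux uy xs⊆ys ys≤xs = unique∧⊆∧⊇⇒↭ ux uy xs⊆ys ys⊆xs
    where
    ys⊆xs : ys ⊆ xs
    ys⊆xs {y} y∈ys with y ∈? xs
    ... | yes y∈xs = y∈xs
    ... | no  y∉xs = ⊥-elim (<-irrefl refl (≤-trans
            (unique∧⊆⇒length≤ (ListAllP.¬Any⇒All¬ xs y∉xs ∷ ux) uy y∷xs⊆ys) ys≤xs))
      where
      y∷xs⊆ys : y ∷ xs ⊆ ys
      y∷xs⊆ys (here refl) = y∈ys
      y∷xs⊆ys (there x∈)  = xs⊆ys x∈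

infix 4 _≡_mod_
_≡_mod_ : ℕ → ℕ → (q : ℕ) → .{{NonZero q}} → Set
_≡_mod_ a b q = a % q ≡ b % q

module ModularArithmetic (q : ℕ) .{{_ : NonZero q}} where
  open ≡-Reasoning

  +-cong-mod : ∀ {a b c d} → a ≡ b mod q → c ≡ d mod q → a + c ≡ b + d mod q
  +-cong-mod {a} {b} {c} {d} a≡b c≡d = begin
    (a + c) % q           ≡⟨ %-distribˡ-+ a c q ⟩
    (a % q + c % q) % q   ≡⟨ cong₂ (λ x y → (x + y) % q) a≡b c≡d ⟩
    (b % q + d % q) % q   ≡⟨ %-distribˡ-+ b d q ⟨
    (b + d) % q           ∎

  *-cong-mod : ∀ {a b c d} → a ≡ b mod q → c ≡ d mod q → a * c ≡ b * d mod q
  *-cong-mod {a} {b} {c} {d} a≡b c≡d = begin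
    (a * c) % q             ≡⟨ %-distribˡ-* a c q ⟩
    (a % q * (c % q)) % q   ≡⟨ cong₂ (λ x y → (x * y) % q) a≡b c≡d ⟩
    (b % q * (d % q)) % q   ≡⟨ %-distribˡ-* b d q ⟨
    (b * d) % q             ∎

  ^-cong-mod-1 : ∀ {a} c → a ≡ 1 mod q → a ^ c ≡ 1 mod q
  ^-cong-mod-1 zero    a≡1 = refl
  ^-cong-mod-1 (suc c) a≡1 = *-cong-mod a≡1 (^-cong-mod-1 c a≡1)

  ≡-mod⇒∣∸ : ∀ {a b} → a ≤ b → a ≡ b mod q → q ∣ b ∸ a
  ≡-mod⇒∣∸ {a} {b} a≤b a≡b = divides (b / q ∸ a / q) (begin
    b ∸ a                                     ≡⟨ cong₂ _∸_ (m≡m%n+[m/n]*n b q) (m≡m%n+[m/n]*n a q) ⟩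
    (b % q + b / q * q) ∸ (a % q + a / q * q) ≡⟨ cong (λ r → (b % q + b / q * q) ∸ (r + a / q * q)) a≡b ⟩
    (b % q + b / q * q) ∸ (b % q + a / q * q) ≡⟨ [m+n]∸[m+o]≡n∸o (b % q) _ _ ⟩
    b / q * q ∸ a / q * q                     ≡⟨ *-distribʳ-∸ q (b / q) (a / q) ⟨
    (b / q ∸ a / q) * q                       ∎)

  private
    *-cancelʳ-≡-mod-≤ : ∀ {a b c} → Coprime c q → a ≤ b → a * c ≡ b * c mod q → a ≡ b mod q
    *-cancelʳ-≡-mod-≤ {a} {b} {c} c⊥q a≤b ac≡bc = sym (begin
      b % q             ≡⟨ cong (_% q) (m+[n∸m]≡n a≤b) ⟨
      (a + (b ∸ a)) % q ≡⟨ %-remove-+ʳ a q∣b∸a ⟩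
      a % q             ∎)
      where
      q∣c[b∸a] : q ∣ c * (b ∸ a)
      q∣c[b∸a] = subst (q ∣_) (sym (*-distribˡ-∸ c b a))
        (subst₂ (λ x y → q ∣ x ∸ y) (*-comm b c) (*-comm a c) (≡-mod⇒∣∸ (*-monoˡ-≤ c a≤b) ac≡bc))
      q∣b∸a : q ∣ b ∸ a
      q∣b∸a = coprime-divisor (Coprimality.sym c⊥q) q∣c[b∸a]

  *-cancelʳ-≡-mod : ∀ {a b c} → Coprime c q → a * c ≡ b * c mod q → a ≡ b mod q
  *-cancelʳ-≡-mod {a} {b} c⊥q ac≡bc with ≤-total a b
  ... | inj₁ a≤b = *-cancelʳ-≡-mod-≤ c⊥q a≤b ac≡bc
  ... | inj₂ b≤a = sym (*-cancelʳ-≡-mod-≤ c⊥q b≤a (sym ac≡bc))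

-- Euler's theorem

coprime-*ʳ : ∀ {m a b} → Coprime m a → Coprime m b → Coprime m (a * b)
coprime-*ʳ {m} {a} {b} m⊥a m⊥b {d} (d∣m , d∣ab) = m⊥b (d∣m , coprime-divisor d⊥a d∣ab)
  where
  d⊥a : Coprime d a
  d⊥a (e∣d , e∣a) = m⊥a (∣-trans e∣d d∣m , e∣a)

coprime-product : ∀ {q} rs → (∀ {r} → r ∈ rs → Coprime r q) → Coprime (product rs) q
coprime-product []       _    = 1-coprimeTo _
coprime-product (r ∷ rs) rs⊥q = Coprimality.sym
  (coprime-*ʳ (Coprimality.sym (rs⊥q (here refl)))
              (Coprimality.sym (coprime-product rs (λ r∈ → rs⊥q (there r∈)))))

coprime-%ˡ : ∀ {a q} .{{_ : NonZero q}} → Coprime a q → Coprime (a % q) q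
coprime-%ˡ a⊥q (d∣a%q , d∣q) = a⊥q (∣n∣m%n⇒∣m d∣q d∣a%q , d∣q)

reducedResidues : ℕ → List ℕ
reducedResidues q = filter (λ r → coprime? r q) (map suc (upTo q))

reducedResidues-unique : ∀ q → Unique (reducedResidues q)
reducedResidues-unique q =
  Unique.filter⁺ (λ r → coprime? r q) (Unique.map⁺ suc-injective (Unique.upTo⁺ q))

module _ {q : ℕ} (1<q : 1 < q) where

  ∈-reducedResidues⁻ : ∀ {r} → r ∈ reducedResidues q → Coprime r q × r < q
  ∈-reducedResidues⁻ r∈ with ∈-filter⁻ (λ r → coprime? r q) {xs = map suc (upTo q)} r∈
  ... | r∈suc[upTo] , r⊥q with ∈-map⁻ suc r∈suc[upTo]
  ... | j , j∈ , refl with m≤n⇒m<n∨m≡n (∈-upTo⁻ j∈)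
  ... | inj₁ r<q  = r⊥q , r<q
  ... | inj₂ refl = ⊥-elim (<⇒≢ 1<q (sym (r⊥q (∣-refl , ∣-refl))))

  ∈-reducedResidues⁺ : ∀ {r} → Coprime r q → r < q → r ∈ reducedResidues q
  ∈-reducedResidues⁺ {zero}  0⊥q _   = ⊥-elim (<⇒≢ 1<q (sym (0-coprimeTo-m⇒m≡1 0⊥q)))
  ∈-reducedResidues⁺ {suc j} r⊥q r<q =
    ∈-filter⁺ (λ r → coprime? r q) (∈-map⁺ suc (∈-upTo⁺ (<⇒≤ r<q))) r⊥q

-- Multiplication by a unit x permutes the reduced residues, so their product
-- P satisfies x ^ φ q * P ≡ P, and P is itself a unit.
module Euler (q : ℕ) .{{_ : NonZero q}} (1<q : 1 < q) {x : ℕ} (x⊥q : Coprime x q) where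
  open ModularArithmetic q
  open ≡-Reasoning

  private
    R : List ℕ
    R = reducedResidues q

  mulX : ℕ → ℕ
  mulX r = x * r % q

  mulX-∈ : ∀ {r} → r ∈ R → mulX r ∈ R
  mulX-∈ {r} r∈ = ∈-reducedResidues⁺ 1<q
    (coprime-%ˡ (Coprimality.sym (coprime-*ʳ (Coprimality.sym x⊥q)
                                            (Coprimality.sym (proj₁ (∈-reducedResidues⁻ 1<q r∈))))))
    (m%n<n (x * r) q)

  map-mulX⊆R : map mulX R ⊆ R
  map-mulX⊆R y∈ with ∈-map⁻ mulX y∈
  ... | r , r∈ , refl = mulX-∈ r∈

  mulX-injective : ∀ {a b} → a ∈ R → b ∈ R → mulX a ≡ mulX b → a ≡ b
  mulX-injective {a} {b} a∈ b∈ xa≡xb = begin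
    a     ≡⟨ m<n⇒m%n≡m (proj₂ (∈-reducedResidues⁻ 1<q a∈)) ⟨
    a % q ≡⟨ *-cancelʳ-≡-mod x⊥q (subst₂ (λ u v → u % q ≡ v % q) (*-comm x a) (*-comm x b) xa≡xb) ⟩
    b % q ≡⟨ m<n⇒m%n≡m (proj₂ (∈-reducedResidues⁻ 1<q b∈)) ⟩
    b     ∎

  map-mulX-↭ : map mulX R ↭ R
  map-mulX-↭ = unique∧⊆∧length≥⇒↭ _≟_
    (unique-map⁺ mulX-injective (reducedResidues-unique q))
    (reducedResidues-unique q)
    map-mulX⊆R
    (≤-reflexive (sym (length-map mulX R)))

  product-map-mulX : ∀ rs → product (map mulX rs) ≡ x ^ length rs * product rs mod q
  product-map-mulX []       = refl
  product-map-mulX (r ∷ rs) =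
    trans (*-cong-mod (m%n%n≡m%n (x * r) q) (product-map-mulX rs))
          (cong (_% q) (solve 4 (λ x r X P → (x :* r) :* (X :* P) := (x :* X) :* (r :* P))
                                refl x r (x ^ length rs) (product rs)))
    where open +-*-Solver

  euler : x ^ φ q ≡ 1 mod q
  euler = *-cancelʳ-≡-mod (coprime-product R (λ r∈ → proj₁ (∈-reducedResidues⁻ 1<q r∈))) (begin
    (x ^ φ q * product R) % q    ≡⟨ product-map-mulX R ⟨
    product (map mulX R) % q    ≡⟨ cong (_% q) (product-↭ map-mulX-↭) ⟩
    product R % q                ≡⟨ cong (_% q) (*-identityˡ (product R)) ⟨
    (1 * product R) % q          ∎)

euler : ∀ q .{{_ : NonZero q}} {x} → Coprime x q → x ^ φ q ≡ 1 mod q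
euler 1                 {x} _   = n%1≡0 (x ^ φ 1)
euler q@(suc (suc _))       x⊥q = Euler.euler q (s≤s (s≤s z≤n)) x⊥q

¬∣⇒coprime : ∀ {p x} → Prime p → ¬ p ∣ x → Coprime x p
¬∣⇒coprime p-prime p∤x (d∣x , d∣p) with prime⇒irreducible p-prime d∣p
... | inj₁ d≡1 = d≡1
... | inj₂ refl = ⊥-elim (p∤x d∣x)

¬∣⇒coprime-^ : ∀ {p x} → Prime p → ¬ p ∣ x → ∀ k → Coprime x (p ^ k)
¬∣⇒coprime-^ p-prime p∤x zero    = Coprimality.sym (1-coprimeTo _)
¬∣⇒coprime-^ p-prime p∤x (suc k) = coprime-*ʳ (¬∣⇒coprime p-prime p∤x) (¬∣⇒coprime-^ p-prime p∤x k)

module _ {p : ℕ} (p-prime : Prime p) where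

  private instance
    p≢0 : NonZero p
    p≢0 = prime⇒nonZero p-prime

  1<p : 1 < p
  1<p = nonTrivial⇒n>1 p {{prime⇒nonTrivial p-prime}}

  -- The residues p ^ (j + 1) - 1 for j < k are distinct and prime to p ^ k.
  k≤φ[p^k] : ∀ k → k ≤ φ (p ^ k)
  k≤φ[p^k] k = subst (_≤ φ (p ^ k)) (length-applyUpTo u k)
    (unique∧⊆⇒length≤ _≟_ (Unique.applyUpTo⁺₁ u k (λ i<j _ → <⇒≢ (u-< i<j)))
                           (reducedResidues-unique (p ^ k)) us⊆R)
    where
    u : ℕ → ℕ
    u j = pred (p ^ suc j)

    u-< : ∀ {i j} → i < j → u i < u j
    u-< {i} i<j = pred-mono-< {{m^n≢0 p (suc i)}} (^-monoʳ-< p 1<p (s≤s i<j))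

    p∤u : ∀ j → ¬ p ∣ u j
    p∤u j p∣u = <⇒≢ 1<p (sym (∣1⇒≡1 (∣m+n∣m⇒∣n p∣u+1 p∣u)))
      where
      p∣u+1 : p ∣ u j + 1
      p∣u+1 = subst (p ∣_) (trans (sym (suc-pred (p ^ suc j) {{m^n≢0 p (suc j)}})) (+-comm 1 (u j)))
                    (m∣m*n (p ^ j))

    us⊆R : applyUpTo u k ⊆ reducedResidues (p ^ k)
    us⊆R y∈ with ∈-applyUpTo⁻ u y∈
    ... | j , j<k , refl = ∈-reducedResidues⁺ (^-monoʳ-< p 1<p {0} {k} (≤-<-trans z≤n j<k))
      (¬∣⇒coprime-^ p-prime (p∤u j) k)
      (<-≤-trans (≤-reflexive (suc-pred (p ^ suc j) {{m^n≢0 p (suc j)}})) (^-monoʳ-≤ p j<k))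

count-¬≡0⇒All : ∀ {A : Set} {P : A → Set} (P? : ∀ x → Dec (P x)) {m} (v : Vec A m) →
  count (λ x → ¬? (P? x)) v ≡ 0 → All P v
count-¬≡0⇒All P? []      _ = []
count-¬≡0⇒All P? (x ∷ v) c≡0 with P? x
... | yes px = px ∷ count-¬≡0⇒All P? v c≡0

module _ {p k n : ℕ} (p-prime : Prime p) (φ[p^k]∣n : φ (p ^ k) ∣ n) .{{_ : NonZero n}} where

  private instance
    p≢0 : NonZero p
    p≢0 = prime⇒nonZero p-prime
    p^k≢0 : NonZero (p ^ k)
    p^k≢0 = m^n≢0 p k

  open ModularArithmetic (p ^ k)

  p^k∣p^n : p ^ k ∣ p ^ n
  p^k∣p^n = divides (p ^ (n ∸ k)) (begin
    p ^ n             ≡⟨ cong (p ^_) (m∸n+n≡m k≤n) ⟨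
    p ^ (n ∸ k + k)   ≡⟨ ^-distribˡ-+-* p (n ∸ k) k ⟩
    p ^ (n ∸ k) * p ^ k ∎)
    where
    open ≡-Reasoning
    k≤n : k ≤ n
    k≤n = ≤-trans (k≤φ[p^k] p-prime k) (∣⇒≤ φ[p^k]∣n)

  ∣⇒p^k∣^ : ∀ {x} → p ∣ x → p ^ k ∣ x ^ n
  ∣⇒p^k∣^ p∣x = ∣-trans p^k∣p^n (^-monoˡ-∣ n p∣x)

  ¬∣⇒^≡1 : ∀ {x} → ¬ p ∣ x → x ^ n ≡ 1 mod p ^ k
  ¬∣⇒^≡1 {x} p∤x = begin
    x ^ n % p ^ k                ≡⟨ cong (λ e → x ^ e % p ^ k) (m∣n⇒n≡m*quotient φ[p^k]∣n) ⟩
    x ^ (φ (p ^ k) * c) % p ^ k  ≡⟨ cong (_% p ^ k) (^-*-assoc x (φ (p ^ k)) c) ⟨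
    (x ^ φ (p ^ k)) ^ c % p ^ k  ≡⟨ ^-cong-mod-1 c (euler (p ^ k) (¬∣⇒coprime-^ p-prime p∤x k)) ⟩
    1 % p ^ k                    ∎
    where
    open ≡-Reasoning
    c : ℕ
    c = quotient φ[p^k]∣n

  powSum≡count : ∀ {m} (v : Vec ℕ m) → powSum n v ≡ count (λ x → ¬? (p ∣? x)) v mod p ^ k
  powSum≡count []      = refl
  powSum≡count (x ∷ v) with p ∣? x
  ... | yes p∣x = trans (%-remove-+ˡ (powSum n v) (∣⇒p^k∣^ p∣x)) (powSum≡count v)
  ... | no  p∤x = +-cong-mod (¬∣⇒^≡1 p∤x) (powSum≡count v)

  p^k∣powSum⇒All∣ : ∀ {m} → m < p ^ k → (v : Vec ℕ m) → p ^ k ∣ powSum n v → All (p ∣_) v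
  p^k∣powSum⇒All∣ m<p^k v p^k∣sum = count-¬≡0⇒All (p ∣?_) v (begin
    count (λ x → ¬? (p ∣? x)) v         ≡⟨ m<n⇒m%n≡m (≤-<-trans (count≤n (λ x → ¬? (p ∣? x)) v) m<p^k) ⟨
    count (λ x → ¬? (p ∣? x)) v % p ^ k ≡⟨ powSum≡count v ⟨
    powSum n v % p ^ k                  ≡⟨ n∣m⇒m%n≡0 _ _ p^k∣sum ⟩
    0                                   ∎)
    where open ≡-Reasoning

-- Counting solutions

All≤powSum : ∀ n .{{_ : NonZero n}} {m} (v : Vec ℕ m) → All (_≤ powSum n v) v
All≤powSum n []      = []
All≤powSum n (x ∷ v) = ≤-trans (m≤m^n x n) (m≤m+n (x ^ n) (powSum n v))
  ∷ All.map (λ y≤ → ≤-trans y≤ (m≤n+m (powSum n v) (x ^ n))) (All≤powSum n v)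

boxVecs-unique : ∀ m d → Unique (boxVecs m d)
boxVecs-unique zero    d = ListAll.[] ∷ []
boxVecs-unique (suc m) d = unique-concatMap⁺ (λ x → map (x ∷_) (boxVecs m d)) head head-∈
  (λ x → Unique.map⁺ ∷-injectiveʳ (boxVecs-unique m d)) (Unique.upTo⁺ (suc d))
  where
  head-∈ : ∀ {x v} → v ∈ map (x ∷_) (boxVecs m d) → head v ≡ x
  head-∈ v∈ with ∈-map⁻ _ v∈
  ... | w , _ , refl = refl

∈-boxVecs⁺ : ∀ {m d} {v : Vec ℕ m} → All (_≤ d) v → v ∈ boxVecs m d
∈-boxVecs⁺ {zero}  {d} {[]}    []          = here refl
∈-boxVecs⁺ {suc m} {d} {x ∷ w} (x≤d ∷ w≤d) =
  ∈-concatMap⁺ (λ x → map (x ∷_) (boxVecs m d)) {xs = upTo (suc d)}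
    (lose (∈-upTo⁺ (s≤s x≤d)) (∈-map⁺ (x ∷_) (∈-boxVecs⁺ w≤d)))

solutions : (m n d : ℕ) → List (Vec ℕ m)
solutions m n d = filter (λ v → powSum n v ≟ d) (boxVecs m d)

solutions-unique : ∀ m n d → Unique (solutions m n d)
solutions-unique m n d = Unique.filter⁺ (λ v → powSum n v ≟ d) (boxVecs-unique m d)

∈-solutions⁺ : ∀ {m n d} .{{_ : NonZero n}} {v : Vec ℕ m} → powSum n v ≡ d → v ∈ solutions m n d
∈-solutions⁺ {n = n} {v = v} refl = ∈-filter⁺ (λ w → powSum n w ≟ powSum n v) (∈-boxVecs⁺ (All≤powSum n v)) refl

∈-solutions⁻ : ∀ {m n d} {v : Vec ℕ m} → v ∈ solutions m n d → powSum n v ≡ d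
∈-solutions⁻ {m} {n} {d} v∈ = proj₂ (∈-filter⁻ (λ v → powSum n v ≟ d) {xs = boxVecs m d} v∈)

scale : ∀ {m} → ℕ → Vec ℕ m → Vec ℕ m
scale c = Vec.map (c *_)

powSum-scale : ∀ {m} n c (v : Vec ℕ m) → powSum n (scale c v) ≡ c ^ n * powSum n v
powSum-scale n c []      = sym (*-zeroʳ (c ^ n))
powSum-scale n c (x ∷ v) = trans (cong₂ _+_ (^-distribʳ-* c x n) (powSum-scale n c v))
  (sym (*-distribˡ-+ (c ^ n) (x ^ n) (powSum n v)))

scale-injective : ∀ {m} c .{{_ : NonZero c}} {v w : Vec ℕ m} → scale c v ≡ scale c w → v ≡ w
scale-injective c {[]}    {[]}    _  = refl
scale-injective c {x ∷ v} {y ∷ w} eq =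
  cong₂ _∷_ (*-cancelˡ-≡ x y c (∷-injectiveˡ eq)) (scale-injective c (∷-injectiveʳ eq))

All∣⇒scale : ∀ {m} c (v : Vec ℕ m) → All (c ∣_) v → Σ (Vec ℕ m) λ w → scale c w ≡ v
All∣⇒scale c []      []                    = [] , refl
All∣⇒scale c (x ∷ v) (divides y refl ∷ c∣v) with All∣⇒scale c v c∣v
... | w , refl = y ∷ w , cong (_∷ scale c w) (*-comm c y)

-- Division by c is then a bijection between the two solution sets.
P[d*cⁿ]≡P[d] : ∀ m n c d .{{_ : NonZero n}} .{{_ : NonZero c}} →
  ((v : Vec ℕ m) → powSum n v ≡ d * c ^ n → All (c ∣_) v) →
  P m n (d * c ^ n) ≡ P m n d
P[d*cⁿ]≡P[d] m n c d solutions-divisible =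
  trans (↭-length solutions↭) (length-map (scale c) (solutions m n d))
  where
  instance
    c^n≢0 : NonZero (c ^ n)
    c^n≢0 = m^n≢0 c n

  to : solutions m n (d * c ^ n) ⊆ map (scale c) (solutions m n d)
  to {v} v∈ with All∣⇒scale c v (solutions-divisible v (∈-solutions⁻ v∈))
  ... | w , refl = ∈-map⁺ (scale c) (∈-solutions⁺ (*-cancelˡ-≡ (powSum n w) d (c ^ n)
        (trans (sym (powSum-scale n c w)) (trans (∈-solutions⁻ v∈) (*-comm d (c ^ n))))))

  from : map (scale c) (solutions m n d) ⊆ solutions m n (d * c ^ n)
  from v∈ with ∈-map⁻ (scale c) v∈
  ... | w , w∈ , refl = ∈-solutions⁺
        (trans (powSum-scale n c w) (trans (cong (c ^ n *_) (∈-solutions⁻ w∈)) (*-comm (c ^ n) d)))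

  solutions↭ : solutions m n (d * c ^ n) ↭ map (scale c) (solutions m n d)
  solutions↭ = unique∧⊆∧⊇⇒↭ (solutions-unique m n (d * c ^ n))
    (Unique.map⁺ (scale-injective c) (solutions-unique m n d)) to from

ScalingInvariant : (m n c : ℕ) → Set
ScalingInvariant m n c = ∀ d → P m n (d * c ^ n) ≡ P m n d

module _ {m n : ℕ} where

  scalingInvariant-1 : ScalingInvariant m n 1
  scalingInvariant-1 d = cong (P m n) (trans (cong (d *_) (^-zeroˡ n)) (*-identityʳ d))

  scalingInvariant-* : ∀ {a b} → ScalingInvariant m n a → ScalingInvariant m n b →
    ScalingInvariant m n (a * b)
  scalingInvariant-* {a} {b} inv-a inv-b d = begin
    P m n (d * (a * b) ^ n)    ≡⟨ cong (P m n) d[ab]ⁿ≡dbⁿaⁿ ⟩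
    P m n (d * b ^ n * a ^ n)  ≡⟨ inv-a (d * b ^ n) ⟩
    P m n (d * b ^ n)          ≡⟨ inv-b d ⟩
    P m n d                    ∎
    where
    open ≡-Reasoning
    open +-*-Solver
    d[ab]ⁿ≡dbⁿaⁿ : d * (a * b) ^ n ≡ d * b ^ n * a ^ n
    d[ab]ⁿ≡dbⁿaⁿ = trans (cong (d *_) (^-distribʳ-* a b n))
      (solve 3 (λ d A B → d :* (A :* B) := d :* B :* A) refl d (a ^ n) (b ^ n))

  scalingInvariant-^ : ∀ {c} → ScalingInvariant m n c → ∀ e → ScalingInvariant m n (c ^ e)
  scalingInvariant-^ inv zero    = scalingInvariant-1
  scalingInvariant-^ inv (suc e) = scalingInvariant-* inv (scalingInvariant-^ inv e)

  scalingInvariant-prodFin-^ : ∀ l (p e : Fin l → ℕ) → (∀ i → ScalingInvariant m n (p i)) →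
    ScalingInvariant m n (prodFin l (λ i → p i ^ e i))
  scalingInvariant-prodFin-^ zero    p e inv = scalingInvariant-1
  scalingInvariant-prodFin-^ (suc l) p e inv = scalingInvariant-*
    (scalingInvariant-^ (inv Fin.zero) (e Fin.zero))
    (scalingInvariant-prodFin-^ l (λ i → p (Fin.suc i)) (λ i → e (Fin.suc i)) (λ i → inv (Fin.suc i)))

scalingInvariant-prime : ∀ {m n p} k .{{_ : NonZero n}} → Prime p → φ (p ^ k) ∣ n → m < p ^ k →
  ScalingInvariant m n p
scalingInvariant-prime {m} {n} {p} k p-prime φ[p^k]∣n m<p^k d =
  P[d*cⁿ]≡P[d] m n p d λ v sum≡ → p^k∣powSum⇒All∣ {k = k} p-prime φ[p^k]∣n m<p^k v
    (subst (p ^ k ∣_) (sym sum≡) (∣-trans (p^k∣p^n {k = k} p-prime φ[p^k]∣n) (n∣m*n d)))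
  where
  instance
    p≢0 : NonZero p
    p≢0 = prime⇒nonZero p-prime

-- Only m < p ^ k and φ (p ^ k) ∣ n are used: neither the parity of n, nor distinctness
-- of the primes, nor eᵢ ≥ 1, nor maximality of the degree.
theorem2 : (n : ℕ) → 2 ∣ n → 2 ≤ n →
    ((m : ℕ) → 2 ≤ m →
      (l : ℕ) (p k : Fin l → ℕ) → Injective _≡_ _≡_ p →
      ((i : Fin l) → IsφDivisorOfDegree n (p i) (k i)) →
      ((i : Fin l) → m ≤ p i ^ k i ∸ 1) →
      (b : ℕ) (e : Fin l → ℕ) → ((i : Fin l) → 1 ≤ e i) →
      P m n (b * prodFin l (λ i → p i ^ e i) ^ n) ≡ P m n b)
    ×
    ((l : ℕ) (p : Fin l → ℕ) → Injective _≡_ _≡_ p →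
      ((i : Fin l) → IsφDivisor n (p i)) →
      (b : ℕ) (e : Fin l → ℕ) → ((i : Fin l) → 1 ≤ e i) →
      P 2 n (b * prodFin l (λ i → p i ^ e i) ^ n) ≡ P 2 n b)
theorem2 n _ 2≤n =
  (λ m _ l p k _ φ-divisor m≤p^k∸1 b e _ → scalingInvariant-prodFin-^ {m} {n} l p e
    (λ i → φDivisorOfDegree-invariant (φ-divisor i) (m≤p^k∸1 i)) b) ,
  (λ l p _ φ-divisor b e _ → scalingInvariant-prodFin-^ {2} {n} l p e
    (λ i → φDivisor-invariant (φ-divisor i)) b)
  where
  instance
    n≢0 : NonZero n
    n≢0 = >-nonZero (≤-trans (s≤s z≤n) 2≤n)

  φDivisorOfDegree-invariant : ∀ {m p k} → IsφDivisorOfDegree n p k → m ≤ p ^ k ∸ 1 →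
    ScalingInvariant m n p
  φDivisorOfDegree-invariant {k = k} (p-prime , _ , 3≤p^k , φ[p^k]∣n , _) m≤p^k∸1 =
    scalingInvariant-prime k p-prime φ[p^k]∣n
      (m≤pred[n]⇒suc[m]≤n {{>-nonZero (≤-trans (s≤s z≤n) 3≤p^k)}} m≤p^k∸1)

  φDivisor-invariant : ∀ {p} → IsφDivisor n p → ScalingInvariant 2 n p
  φDivisor-invariant (p-prime , k , _ , 3≤p^k , φ[p^k]∣n) =
    scalingInvariant-prime k p-prime φ[p^k]∣n 3≤p^k
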